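{- Let $d\ge 2$, $k\ge 1$, $\varepsilon\in(0,1)$, and let $\mathbf{A}'$ be an $n\times d$ matrix whose maximum $k$-coverage satisfies $\mathbf{OPT}\le C_1\, k\log d/\varepsilon^2$ for a constant $C_1$. Then the number of rows of $\mathbf{A}'$ having at least $d/k$ nonzero entries is $O(k\log d/\varepsilon^2)$.
   Context: Rows of $\mathbf{A}'$ are items and columns are subsets; item $i$ belongs to subset $j$ iff $A'_{ij}\neq0$. The coverage of a set $\mathcal{C}$ of columns is the number of rows with a nonzero entry in some column of $\mathcal{C}$, and $\mathbf{OPT}$ is the maximum coverage over sets of $k$ columns. The constant in the $O(\cdot)$ depends only on $C_1$.
   Formalization: The constant $C_1$, the parameter ε and the entries of $\mathbf{A}'$ are rational. -}

module Defs where

open import Data.Nat using (ℕ; zero; suc; _+_; _*_; _^_; _≤_)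
open import Data.Bool using (Bool; true; false; not; _∧_; _∨_; if_then_else_)
open import Data.Fin using (Fin; zero; suc)
open import Data.Fin.Subset using (Subset; inside; outside)
open import Data.Vec using (lookup)
open import Data.Fin.Subset using (Side)
open import Data.Rational using (ℚ; 0ℚ; _≟_)
open import Relation.Nullary.Decidable using (⌊_⌋)

-- An n × d matrix with rational entries (only the support matters).
Matrix : ℕ → ℕ → Set
Matrix n d = Fin n → Fin d → ℚ

count : ∀ {m} → (Fin m → Bool) → ℕ
count {zero}  f = 0
count {suc m} f = (if f zero then 1 else 0) + count (λ i → f (suc i))

nz : ℚ → Bool
nz x = not ⌊ x ≟ 0ℚ ⌋

anyF : ∀ {m} → (Fin m → Bool) → Bool
anyF {zero}  f = false
anyF {suc m} f = f zero ∨ anyF (λ i → f (suc i))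

isIn : Side → Bool
isIn inside  = true
isIn outside = false

covers : ∀ {n d} → Matrix n d → Subset d → Fin n → Bool
covers A S i = anyF (λ j → isIn (lookup S j) ∧ nz (A i j))

coverage : ∀ {n d} → Matrix n d → Subset d → ℕ
coverage A S = count (covers A S)

nnzRow : ∀ {n d} → Matrix n d → Fin n → ℕ
nnzRow A i = count (λ j → nz (A i j))

-- row i has at least d/k nonzero entries  ⇔  k * nnz ≥ d
heavyB : ∀ {n d} → Matrix n d → ℕ → Fin n → Bool
heavyB {d = d} A k i = ⌊ d Data.Nat.≤? (k * nnzRow A i) ⌋

heavyCount : ∀ {n d} → Matrix n d → ℕ → ℕ
heavyCount A k = count (heavyB A k)

-- x ≤ m · log₂ d  (real logarithm), written exactly in ℕ as 2^x ≤ d^m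
_≤_·log₂_ : ℕ → ℕ → ℕ → Set
x ≤ m ·log₂ d = 2 ^ x ≤ d ^ m

{-# OPTIONS --safe #-}
-- Double counting the nonzero entries of rows that each have at least d/k of them shows that some
-- column meets at least a 1/k fraction of these rows. Adding such a column greedily to
-- the chosen set preserves  t · #(uncovered heavy rows) ≤ k · #(covered heavy rows)  after t steps,
-- so k columns cover at least half of the heavy rows: #heavy ≤ 2 · OPT. With C₁ = p/q and q ≥ 1
-- the bound on OPT then gives the claim with C₂ = 2p.
module Submission where

open import Defs
open import Data.Nat using (ℕ; zero; suc; _+_; _*_; _^_; _≤_; _<_; z≤n; s≤s; _≤?_; NonZero; >-nonZero)
open import Data.Nat.Properties
open import Data.Product using (Σ; ∃-syntax; _×_; _,_; proj₁; proj₂)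
open import Data.Bool using (Bool; true; false; not; _∧_; _∨_; T)
open import Data.Fin using (Fin; zero; suc)
open import Data.Fin.Properties using (any?)
open import Data.Fin.Subset using (Subset; ∣_∣; ⊥; inside; outside)
open import Data.Fin.Subset.Properties using (∣p∣≤∣x∷p∣; ∣⊥∣≡0)
open import Data.Vec using (_∷_; lookup; _[_]≔_)
open import Data.Bool.Properties using (∨-assoc; ∨-identityʳ; ∨-zeroʳ; T-∧)
open import Algebra.Properties.Semiring.Sum +-*-semiring using (sum-syntax; sum-cong-≗; ∑-comm; ∑-distrib-+; *-distribˡ-sum)
open import Relation.Binary.PropositionalEquality using (_≡_; refl; sym; cong; cong₂; subst; subst₂; module ≡-Reasoning)
open import Relation.Nullary using (yes; no; contradiction)
open import Relation.Nullary.Decidable using (toWitness)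
open import Function using (_∘_; Equivalence)

∑-mono-≤ : ∀ {m} {f g : Fin m → ℕ} → (∀ i → f i ≤ g i) → ∑[ i < m ] f i ≤ ∑[ i < m ] g i
∑-mono-≤ {zero}  f≤g = z≤n
∑-mono-≤ {suc m} f≤g = +-mono-≤ (f≤g zero) (∑-mono-≤ (λ i → f≤g (suc i)))

∑-mono-< : ∀ {m} {f g : Fin (suc m) → ℕ} → (∀ i → f i < g i) → ∑[ i < suc m ] f i < ∑[ i < suc m ] g i
∑-mono-< f<g = +-mono-<-≤ (f<g zero) (∑-mono-≤ (λ i → <⇒≤ (f<g (suc i))))

∑-const : ∀ m x → ∑[ i < m ] x ≡ m * x
∑-const zero    x = refl
∑-const (suc m) x = cong (x +_) (∑-const m x)

∑-average : ∀ {m} .{{_ : NonZero m}} (f : Fin m → ℕ) x →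
  m * x ≤ ∑[ i < m ] f i → ∃[ i ] x ≤ f i
∑-average {suc m} f x m*x≤∑f with any? (λ i → x ≤? f i)
... | yes found = found
... | no  none  = contradiction m*x≤∑f (<⇒≱ (begin-strict
    ∑[ i < suc m ] f i   <⟨ ∑-mono-< (λ i → ≰⇒> (λ x≤fi → none (i , x≤fi))) ⟩
    ∑[ i < suc m ] x     ≡⟨ ∑-const (suc m) x ⟩
    suc m * x            ∎))
  where open ≤-Reasoning

indicator : Bool → ℕ
indicator true  = 1
indicator false = 0

count≡∑ : ∀ {m} (p : Fin m → Bool) → count p ≡ ∑[ i < m ] indicator (p i)
count≡∑ {zero}  p = refl
count≡∑ {suc m} p with p zero
... | true  = cong suc (count≡∑ (λ i → p (suc i)))
... | false = count≡∑ (λ i → p (suc i))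

count-mono : ∀ {m} {p q : Fin m → Bool} → (∀ i → T (p i) → T (q i)) → count p ≤ count q
count-mono {p = p} {q} p⇒q = subst₂ _≤_ (sym (count≡∑ p)) (sym (count≡∑ q)) (∑-mono-≤ indicator-mono)
  where
  indicator-mono : ∀ i → indicator (p i) ≤ indicator (q i)
  indicator-mono i with p i | q i | p⇒q i
  ... | false | _     | _   = z≤n
  ... | true  | true  | _   = ≤-refl
  ... | true  | false | p⇒q = contradiction _ p⇒q

count-split : ∀ {m} (r p q : Fin m → Bool) →
  (∀ i → indicator (r i) ≡ indicator (p i) + indicator (q i)) → count r ≡ count p + count q
count-split {m} r p q split = begin
  count r                                                  ≡⟨ count≡∑ r ⟩
  ∑[ i < m ] indicator (r i)                               ≡⟨ sum-cong-≗ split ⟩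
  ∑[ i < m ] (indicator (p i) + indicator (q i))           ≡⟨ ∑-distrib-+ (indicator ∘ p) (indicator ∘ q) ⟩
  ∑[ i < m ] indicator (p i) + ∑[ i < m ] indicator (q i)  ≡⟨ cong₂ _+_ (count≡∑ p) (count≡∑ q) ⟨
  count p + count q                                        ∎
  where open ≡-Reasoning

count-comm : ∀ {m n} (M : Fin m → Fin n → Bool) →
  ∑[ i < m ] count (M i) ≡ ∑[ j < n ] count (λ i → M i j)
count-comm {m} {n} M = begin
  ∑[ i < m ] count (M i)                       ≡⟨ sum-cong-≗ (λ i → count≡∑ (M i)) ⟩
  ∑[ i < m ] ∑[ j < n ] indicator (M i j)      ≡⟨ ∑-comm (λ i j → indicator (M i j)) ⟩
  ∑[ j < n ] ∑[ i < m ] indicator (M i j)      ≡⟨ sum-cong-≗ (λ j → count≡∑ (λ i → M i j)) ⟨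
  ∑[ j < n ] count (λ i → M i j)               ∎
  where open ≡-Reasoning

dense-rows⇒busy-column : ∀ {m n} .{{_ : NonZero n}} k (M : Fin m → Fin n → Bool) (P : Fin m → Bool) →
  (∀ i → T (P i) → n ≤ k * count (M i)) → ∃[ j ] count P ≤ k * count (λ i → P i ∧ M i j)
dense-rows⇒busy-column {m} {n} k M P dense = ∑-average (λ j → k * meets j) (count P) (begin
  n * count P                                 ≡⟨ cong (n *_) (count≡∑ P) ⟩
  n * ∑[ i < m ] indicator (P i)              ≡⟨ *-distribˡ-sum n (indicator ∘ P) ⟩
  ∑[ i < m ] (n * indicator (P i))            ≤⟨ ∑-mono-≤ row-bound ⟩
  ∑[ i < m ] (k * count (λ j → P i ∧ M i j))  ≡⟨ *-distribˡ-sum k (λ i → count (λ j → P i ∧ M i j)) ⟨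
  k * ∑[ i < m ] count (λ j → P i ∧ M i j)    ≡⟨ cong (k *_) (count-comm (λ i j → P i ∧ M i j)) ⟩
  k * ∑[ j < n ] meets j                      ≡⟨ *-distribˡ-sum k meets ⟩
  ∑[ j < n ] (k * meets j)                    ∎)
  where
  open ≤-Reasoning
  meets : Fin n → ℕ
  meets j = count (λ i → P i ∧ M i j)
  row-bound : ∀ i → n * indicator (P i) ≤ k * count (λ j → P i ∧ M i j)
  row-bound i with P i | dense i
  ... | false | _         = ≤-trans (≤-reflexive (*-zeroʳ n)) z≤n
  ... | true  | n≤k*count = ≤-trans (≤-reflexive (*-identityʳ n)) (n≤k*count _)

∣p[i]≔inside∣≤1+∣p∣ : ∀ {d} (S : Subset d) j → ∣ S [ j ]≔ inside ∣ ≤ suc ∣ S ∣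
∣p[i]≔inside∣≤1+∣p∣ (s ∷ S)       zero    = s≤s (∣p∣≤∣x∷p∣ s S)
∣p[i]≔inside∣≤1+∣p∣ (inside ∷ S)  (suc j) = s≤s (∣p[i]≔inside∣≤1+∣p∣ S j)
∣p[i]≔inside∣≤1+∣p∣ (outside ∷ S) (suc j) = ∣p[i]≔inside∣≤1+∣p∣ S j

covers-insert : ∀ {n d} (A : Matrix n d) S j i → covers A (S [ j ]≔ inside) i ≡ covers A S i ∨ nz (A i j)
covers-insert A S j i = anyF-insert S j (nz ∘ A i)
  where
  anyF-insert : ∀ {d} (S : Subset d) j (f : Fin d → Bool) →
    anyF (λ j′ → isIn (lookup (S [ j ]≔ inside) j′) ∧ f j′) ≡ anyF (λ j′ → isIn (lookup S j′) ∧ f j′) ∨ f j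
  anyF-insert (s ∷ S) zero f with s | f zero
  ... | inside  | true  = refl
  ... | inside  | false = sym (∨-identityʳ _)
  ... | outside | true  = sym (∨-zeroʳ _)
  ... | outside | false = sym (∨-identityʳ _)
  anyF-insert (s ∷ S) (suc j) f rewrite anyF-insert S j (f ∘ suc) = sym (∨-assoc (isIn s ∧ f zero) _ _)

indicator-∧-not : ∀ r c → indicator r ≡ indicator (r ∧ c) + indicator (r ∧ not c)
indicator-∧-not false c     = refl
indicator-∧-not true  true  = refl
indicator-∧-not true  false = refl

indicator-∧-∨ : ∀ r c m → indicator (r ∧ (c ∨ m)) ≡ indicator (r ∧ c) + indicator ((r ∧ not c) ∧ m)
indicator-∧-∨ false c     m = refl
indicator-∧-∨ true  true  m = refl
indicator-∧-∨ true  false m = refl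

indicator-∧-not-∨ : ∀ r c m →
  indicator (r ∧ not c) ≡ indicator (r ∧ not (c ∨ m)) + indicator ((r ∧ not c) ∧ m)
indicator-∧-not-∨ false c     m     = refl
indicator-∧-not-∨ true  true  m     = refl
indicator-∧-not-∨ true  false true  = refl
indicator-∧-not-∨ true  false false = refl

greedy-step-bound : ∀ t k {u u′ c g} → u ≡ u′ + g → t * u ≤ k * c → u ≤ k * g → suc t * u′ ≤ k * (c + g)
greedy-step-bound t k {u} {u′} {c} {g} u≡u′+g t*u≤k*c u≤k*g = begin
  suc t * u′     ≤⟨ *-monoʳ-≤ (suc t) (≤-trans (m≤m+n u′ g) (≤-reflexive (sym u≡u′+g))) ⟩
  u + t * u      ≤⟨ +-mono-≤ u≤k*g t*u≤k*c ⟩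
  k * g + k * c  ≡⟨ +-comm (k * g) (k * c) ⟩
  k * c + k * g  ≡⟨ *-distribˡ-+ k c g ⟨
  k * (c + g)    ∎
  where open ≤-Reasoning

module GreedyCover {n d} (A : Matrix n d) (k : ℕ) .{{_ : NonZero d}}
  (R : Fin n → Bool) (R-dense : ∀ i → T (R i) → d ≤ k * nnzRow A i) where

  covered uncovered : Subset d → Fin n → Bool
  covered   S i = R i ∧ covers A S i
  uncovered S i = R i ∧ not (covers A S i)

  newlyCovered : Subset d → Fin d → Fin n → Bool
  newlyCovered S j i = uncovered S i ∧ nz (A i j)

  count-covered+uncovered : ∀ S → count R ≡ count (covered S) + count (uncovered S)
  count-covered+uncovered S =
    count-split R (covered S) (uncovered S) (λ i → indicator-∧-not (R i) (covers A S i))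

  count-covered-insert : ∀ S j →
    count (covered (S [ j ]≔ inside)) ≡ count (covered S) + count (newlyCovered S j)
  count-covered-insert S j = count-split _ _ _ split
    where
    split : ∀ i → indicator (covered (S [ j ]≔ inside) i)
                ≡ indicator (covered S i) + indicator (newlyCovered S j i)
    split i rewrite covers-insert A S j i = indicator-∧-∨ (R i) (covers A S i) (nz (A i j))

  count-uncovered-insert : ∀ S j →
    count (uncovered S) ≡ count (uncovered (S [ j ]≔ inside)) + count (newlyCovered S j)
  count-uncovered-insert S j = count-split _ _ _ split
    where
    split : ∀ i → indicator (uncovered S i)
                ≡ indicator (uncovered (S [ j ]≔ inside) i) + indicator (newlyCovered S j i)
    split i rewrite covers-insert A S j i = indicator-∧-not-∨ (R i) (covers A S i) (nz (A i j))

  busy-column : ∀ S → ∃[ j ] count (uncovered S) ≤ k * count (newlyCovered S j)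
  busy-column S =
    dense-rows⇒busy-column k (λ i j → nz (A i j)) (uncovered S) (λ i → R-dense i ∘ proj₁ ∘ Equivalence.to T-∧)

  greedy : ∀ t → ∃[ S ] ∣ S ∣ ≤ t × t * count (uncovered S) ≤ k * count (covered S)
  greedy zero = ⊥ , ≤-reflexive (∣⊥∣≡0 d) , z≤n
  greedy (suc t) with greedy t
  ... | S , ∣S∣≤t , invariant with busy-column S
  ...   | j , busy = S [ j ]≔ inside , ≤-trans (∣p[i]≔inside∣≤1+∣p∣ S j) (s≤s ∣S∣≤t) ,
    ≤-trans (greedy-step-bound t k (count-uncovered-insert S j) invariant busy)
            (≤-reflexive (cong (k *_) (sym (count-covered-insert S j))))

  half-cover : .{{_ : NonZero k}} → ∃[ S ] ∣ S ∣ ≤ k × count R ≤ 2 * coverage A S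
  half-cover with greedy k
  ... | S , ∣S∣≤k , k*U≤k*C = S , ∣S∣≤k , (begin
    count R                                 ≡⟨ count-covered+uncovered S ⟩
    count (covered S) + count (uncovered S) ≤⟨ +-monoʳ-≤ (count (covered S)) (*-cancelˡ-≤ k k*U≤k*C) ⟩
    count (covered S) + count (covered S)   ≡⟨ cong (count (covered S) +_) (+-identityʳ _) ⟨
    2 * count (covered S)                   ≤⟨ *-monoʳ-≤ 2 (count-mono covered⇒covers) ⟩
    2 * coverage A S                        ∎)
    where
    open ≤-Reasoning
    covered⇒covers : ∀ i → T (covered S i) → T (covers A S i)
    covered⇒covers i = proj₂ ∘ Equivalence.to T-∧

≤-trans-·log₂ : ∀ {y x} m d → y ≤ x → x ≤ m ·log₂ d → y ≤ m ·log₂ d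
≤-trans-·log₂ m d y≤x = ≤-trans (^-monoʳ-≤ 2 y≤x)

*-mono-·log₂ : ∀ c x m d → x ≤ m ·log₂ d → (c * x) ≤ (c * m) ·log₂ d
*-mono-·log₂ c x m d x≤m·log₂d = begin
  2 ^ (c * x)   ≡⟨ cong (2 ^_) (*-comm c x) ⟩
  2 ^ (x * c)   ≡⟨ ^-*-assoc 2 x c ⟨
  (2 ^ x) ^ c   ≤⟨ ^-monoˡ-≤ c x≤m·log₂d ⟩
  (d ^ m) ^ c   ≡⟨ ^-*-assoc d m c ⟩
  d ^ (m * c)   ≡⟨ cong (d ^_) (*-comm m c) ⟩
  d ^ (c * m)   ∎
  where open ≤-Reasoning

heavyCount≤2*coverage : ∀ {n d} (A : Matrix n d) k .{{_ : NonZero d}} .{{_ : NonZero k}} →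
  ∃[ S ] ∣ S ∣ ≤ k × heavyCount A k ≤ 2 * coverage A S
heavyCount≤2*coverage A k = GreedyCover.half-cover A k (heavyB A k) (λ i → toWitness)

lemma3p3 : (p q : ℕ) → 1 ≤ q →
    Σ ℕ (λ C₂ →
      (d k n a b : ℕ) (A : Matrix n d) →
      2 ≤ d → 1 ≤ k → 0 < a → a < b →
      ((S : Subset d) → ∣ S ∣ ≤ k →
        (coverage A S * q * a ^ 2) ≤ (p * k * b ^ 2) ·log₂ d) →
      (heavyCount A k * a ^ 2) ≤ (C₂ * k * b ^ 2) ·log₂ d)
lemma3p3 p q 1≤q = 2 * p , λ d k n a b A 2≤d 1≤k _ _ opt-bound →
  let S , ∣S∣≤k , heavy≤2*cov =
        heavyCount≤2*coverage A k {{>-nonZero (≤-trans (s≤s z≤n) 2≤d)}} {{>-nonZero 1≤k}}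
  in subst (λ m → (heavyCount A k * a ^ 2) ≤ m ·log₂ d) (2*[p*k*b²]≡2*p*k*b² k b)
       (≤-trans-·log₂ (2 * (p * k * b ^ 2)) d
         (h≤2c⇒h*a²≤2*[c*q*a²] (heavyCount A k) (coverage A S) a heavy≤2*cov)
         (*-mono-·log₂ 2 (coverage A S * q * a ^ 2) (p * k * b ^ 2) d (opt-bound S ∣S∣≤k)))
  where
  instance
    q≢0 : NonZero q
    q≢0 = >-nonZero 1≤q
  h≤2c⇒h*a²≤2*[c*q*a²] : ∀ h c a → h ≤ 2 * c → h * a ^ 2 ≤ 2 * (c * q * a ^ 2)
  h≤2c⇒h*a²≤2*[c*q*a²] h c a h≤2c = begin
    h * a ^ 2             ≤⟨ *-monoˡ-≤ (a ^ 2) (≤-trans h≤2c (*-monoʳ-≤ 2 (m≤m*n c q))) ⟩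
    2 * (c * q) * a ^ 2   ≡⟨ *-assoc 2 (c * q) (a ^ 2) ⟩
    2 * (c * q * a ^ 2)   ∎
    where open ≤-Reasoning
  2*[p*k*b²]≡2*p*k*b² : ∀ k b → 2 * (p * k * b ^ 2) ≡ 2 * p * k * b ^ 2
  2*[p*k*b²]≡2*p*k*b² k b = begin
    2 * (p * k * b ^ 2)   ≡⟨ *-assoc 2 (p * k) (b ^ 2) ⟨
    2 * (p * k) * b ^ 2   ≡⟨ cong (_* b ^ 2) (*-assoc 2 p k) ⟨
    2 * p * k * b ^ 2     ∎
    where open ≡-Reasoning
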